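{- Let $n\ge 1$ be an integer and $N=2^n$. For every non-trivial bipartite graph $G\subseteq[N]\times[N]$ (i.e. $G\neq\emptyset$ and $G\neq[N]\times[N]$) and its corresponding Boolean function $f_G\colon\{0,1\}^n\times\{0,1\}^n\to\{0,1\}$, we have $$\rho\big(f_G^{ -1}(1),\mathcal B_{2n}\big)\;\ge\;\rho\big(G,\mathcal G_{N,N}\big)\qquad\text{and}\qquad D\big(f_G^{ -1}(1)\mid\mathcal B_{2n}\big)\;\ge\;D_\cap\big(G\mid\mathcal G_{N,N}\big).$$
   Context: Discrete complexity: let $\Gamma$ be a nonempty finite set and $\mathcal B$ a family of subsets of $\Gamma$ (generators). A sequence $A_1,\dots,A_t$ ($t\ge1$) of subsets of $\Gamma$ generates $A$ from $\mathcal B$ if $A_t=A$ and each $A_i$ equals $X\cup Y$ or $X\cap Y$ for some (not necessarily distinct) $X,Y\in\mathcal B\cup\{A_1,\dots,A_{i-1}\}$. $D(A\mid\mathcal B)$ is the minimum such $t$ ($\infty$ if none exists); $D_\cap(A\mid\mathcal B)$ is the minimum number of intersection steps over all sequences generating $A$ from $\mathcal B$ ($\infty$ if none). Cover complexity: for $A\subseteq\Gamma$ let $U=\Gamma\setminus A$. A semi-filter over $U$ is a nonempty family $\mathcal F\subseteq\mathcal P(U)$ with $\emptyset\notin\mathcal F$ such that $U_1\in\mathcal F$ and $U_1\subseteq U_2\subseteq U$ imply $U_2\in\mathcal F$. $\mathcal F$ is above $w\in\Gamma$ (w.r.t. $\mathcal B$ and $U$) if for every $B\in\mathcal B$ with $w\in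 B$ we have $B\cap U\in\mathcal F$. $\mathcal F$ preserves a pair $(E,H)$ of subsets of $U$ if $E\in\mathcal F$ and $H\in\mathcal F$ imply $E\cap H\in\mathcal F$, and preserves a collection $\Lambda$ of pairs if it preserves each pair in it. $\rho(A,\mathcal B)$ is the minimum size of a collection $\Lambda$ of pairs of subsets of $U$ such that there is no semi-filter over $U$ that preserves $\Lambda$ and is above some element $a\in A$ ($\infty$ if no such $\Lambda$ exists). Generators: $\mathcal G_{N,N}=\{R_1,\dots,R_N,C_1,\dots,C_N\}$ on $\Gamma=[N]\times[N]$, where $R_i=\{(i,j):j\in[N]\}$, $C_j=\{(i,j):i\in[N]\}$. $\mathcal B_{m}=\{B_1,\dots,B_m,B_1^c,\dots,B_m^c\}$ on $\Gamma=\{0,1\}^m$, where $B_i=\{v\in\{0,1\}^m: v_i=1\}$ and $^c$ is complement in $\{0,1\}^m$. The function $f_G$: let $\mathrm{bin}\colon[N]\to\{0,1\}^n$ map $k$ to the $n$-bit binary representation (most significant bit first) of $k-1$, and $\phi(u,v)=\mathrm{bin}(u)\mathrm{bin}(v)\in\{0,1\}^{2n}$ (concatenation); $f_G$ is the function with $f_G^{ -1}(1)=\phi(G)$. -}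

module Defs where

open import Data.Bool using (Bool; true; false; _∧_; _∨_; not)
open import Data.Nat using (ℕ; zero; suc; _+_; _^_; _≤_; _%_; _/_; _≡ᵇ_)
open import Data.Fin using (Fin; toℕ; _≟_)
open import Data.Vec using (Vec; []; _∷_; _∷ʳ_; _++_; lookup)
open import Data.List using (List; []; _∷_; length; map; allFin) renaming (_++_ to _++ˡ_)
open import Data.Bool.ListAction using (any)
open import Data.List.Membership.Propositional using (_∈_)
open import Data.List.Relation.Unary.All using (All)
open import Data.Product using (Σ; ∃; _×_; _,_; proj₁; proj₂)
open import Relation.Nullary using (¬_)
open import Relation.Nullary.Decidable using (⌊_⌋)
open import Relation.Binary.PropositionalEquality using (_≡_)

Sub : Set → Set
Sub Γ = Γ → Bool

module _ {Γ : Set} where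

  _∪ˢ_ : Sub Γ → Sub Γ → Sub Γ
  (X ∪ˢ Y) x = X x ∨ Y x

  _∩ˢ_ : Sub Γ → Sub Γ → Sub Γ
  (X ∩ˢ Y) x = X x ∧ Y x

  ∁ : Sub Γ → Sub Γ
  ∁ X x = not (X x)

  ∅ˢ : Sub Γ
  ∅ˢ _ = false

  _⊆ˢ_ : Sub Γ → Sub Γ → Set
  X ⊆ˢ Y = ∀ x → X x ≡ true → Y x ≡ true

  _≈ˢ_ : Sub Γ → Sub Γ → Set
  X ≈ˢ Y = ∀ x → X x ≡ Y x

-- Discrete complexity.
-- GenSeq 𝓑 As k : As is the reversed list A_i, ..., A_1 of a valid sequence
-- of ∪/∩ steps from the generators 𝓑, with exactly k intersection steps.

  data GenSeq (𝓑 : List (Sub Γ)) : List (Sub Γ) → ℕ → Set where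
    []   : GenSeq 𝓑 [] 0
    ∪stp : ∀ {As k X Y} → GenSeq 𝓑 As k → X ∈ (𝓑 ++ˡ As) → Y ∈ (𝓑 ++ˡ As) →
           GenSeq 𝓑 ((X ∪ˢ Y) ∷ As) k
    ∩stp : ∀ {As k X Y} → GenSeq 𝓑 As k → X ∈ (𝓑 ++ˡ As) → Y ∈ (𝓑 ++ˡ As) →
           GenSeq 𝓑 ((X ∩ˢ Y) ∷ As) (suc k)

  Generates : List (Sub Γ) → Sub Γ → ℕ → ℕ → Set
  Generates 𝓑 A t k =
    Σ (Sub Γ) λ Aₜ → Σ (List (Sub Γ)) λ rest →
      GenSeq 𝓑 (Aₜ ∷ rest) k × suc (length rest) ≡ t × Aₜ ≈ˢ A

  record SemiFilter (U : Sub Γ) : Set₁ where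
    field
      𝓕        : Sub Γ → Set
      inP      : ∀ X → 𝓕 X → X ⊆ˢ U
      nonempty : Σ (Sub Γ) 𝓕
      no∅      : ¬ 𝓕 ∅ˢ
      upward   : ∀ X Y → 𝓕 X → X ⊆ˢ Y → Y ⊆ˢ U → 𝓕 Y

  open SemiFilter public

  Above : (𝓑 : List (Sub Γ)) (U : Sub Γ) → SemiFilter U → Γ → Set
  Above 𝓑 U F w = ∀ B → B ∈ 𝓑 → B w ≡ true → 𝓕 F (B ∩ˢ U)

  PreservesPair : {U : Sub Γ} → SemiFilter U → Sub Γ × Sub Γ → Set
  PreservesPair F (E , H) = 𝓕 F E → 𝓕 F H → 𝓕 F (E ∩ˢ H)

  Preserves : {U : Sub Γ} → SemiFilter U → List (Sub Γ × Sub Γ) → Set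
  Preserves F Λ = All (PreservesPair F) Λ

  -- Λ witnesses ρ(A,𝓑) ≤ length Λ: Λ is a collection of pairs of subsets of
  -- U = Γ ∖ A such that no semi-filter over U preserving Λ is above some a ∈ A.
  RhoWitness : Sub Γ → List (Sub Γ) → List (Sub Γ × Sub Γ) → Set₁
  RhoWitness A 𝓑 Λ =
    All (λ p → (proj₁ p ⊆ˢ ∁ A) × (proj₂ p ⊆ˢ ∁ A)) Λ ×
    ¬ (Σ (SemiFilter (∁ A)) λ F → Σ Γ λ a →
         (A a ≡ true) × Above 𝓑 (∁ A) F a × Preserves F Λ)

Row : (N : ℕ) → Fin N → Sub (Fin N × Fin N)
Row N i (a , b) = ⌊ a ≟ i ⌋

Col : (N : ℕ) → Fin N → Sub (Fin N × Fin N)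
Col N j (a , b) = ⌊ b ≟ j ⌋

𝓖 : (N : ℕ) → List (Sub (Fin N × Fin N))
𝓖 N = map (Row N) (allFin N) ++ˡ map (Col N) (allFin N)

Bit : (m : ℕ) → Fin m → Sub (Vec Bool m)
Bit m i v = lookup v i

𝓑 : (m : ℕ) → List (Sub (Vec Bool m))
𝓑 m = map (Bit m) (allFin m) ++ˡ map (λ i → ∁ (Bit m i)) (allFin m)

-- n-bit binary representation of a natural number, most significant bit first.
binℕ : (n : ℕ) → ℕ → Vec Bool n
binℕ zero    m = []
binℕ (suc n) m = binℕ n (m / 2) ∷ʳ (m % 2 ≡ᵇ 1)

-- bin(k) = binary representation of k-1 for k ∈ [N]; with 0-based Fin (2^n),
-- the element i stands for k = toℕ i + 1, so bin is that of toℕ i.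
bin : (n : ℕ) → Fin (2 ^ n) → Vec Bool n
bin n i = binℕ n (toℕ i)

φ : (n : ℕ) → Fin (2 ^ n) → Fin (2 ^ n) → Vec Bool (n + n)
φ n u v = bin n u ++ bin n v

eqBits : ∀ {m} → Vec Bool m → Vec Bool m → Bool
eqBits [] [] = true
eqBits (true ∷ xs) (true ∷ ys) = eqBits xs ys
eqBits (false ∷ xs) (false ∷ ys) = eqBits xs ys
eqBits (_ ∷ _) (_ ∷ _) = false

-- f_G^{-1}(1) = φ(G), the image of G under φ.
fG⁻¹1 : (n : ℕ) → Sub (Fin (2 ^ n) × Fin (2 ^ n)) → Sub (Vec Bool (n + n))
fG⁻¹1 n G w =
  any (λ u → any (λ v → G (u , v) ∧ eqBits (φ n u v) w) (allFin (2 ^ n)))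
      (allFin (2 ^ n))

NonTrivial : ∀ {Γ : Set} → Sub Γ → Set
NonTrivial {Γ} G = (Σ Γ λ p → G p ≡ true) × (Σ Γ λ p → G p ≡ false)

{-# OPTIONS --safe #-}
-- φ(u, v) = bin u ++ bin v is injective and φ⁻¹(f_G⁻¹(1)) = G, while every generator of 𝓑_{2n}
-- (a bit of u or of v, or its negation) pulls back along φ to a nonempty union of rows or a
-- nonempty union of columns. So a generating sequence for f_G⁻¹(1) pulls back to one for G in
-- which each generator is rebuilt by union steps alone, which adds no intersection steps.
-- Dually, a semi-filter over Γ ∖ G pushes forward along φ: a generator through φ(a) pulls back
-- to a superset of the row or column through a, so being above a is kept, and the pushforward
-- preserves Λ whenever the original preserves the pulled-back pairs φ⁻¹(Λ).
module Submission where

open import Defs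
open import Data.Bool using (Bool; true; false; not; _∧_; _∨_)
open import Data.Bool.ListAction using (any)
open import Data.Bool.Properties using (T-≡; ∧-conicalˡ; ∧-conicalʳ; ∨-idem; ∨-zeroʳ)
open import Data.Fin using (Fin; toℕ; fromℕ<; splitAt; _≟_)
open import Data.Fin.Properties using (toℕ-injective; toℕ-fromℕ<; toℕ<n)
open import Data.List using (List; []; _∷_; length; map; allFin) renaming (_++_ to _++ˡ_)
open import Data.List.Properties using (length-map)
open import Data.List.Membership.Propositional using (_∈_; lose)
open import Data.List.Membership.Propositional.Properties
  using (∈-++⁺ˡ; ∈-++⁺ʳ; ∈-++⁻; ∈-map⁺; ∈-map⁻; ∈-allFin)
open import Data.List.Relation.Binary.Subset.Propositional using (_⊆_)
open import Data.List.Relation.Binary.Subset.Propositional.Properties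
  using (⊆-refl; ⊆-trans; xs⊆x∷xs; ++⁺ʳ)
import Data.List.Relation.Unary.All as All
import Data.List.Relation.Unary.All.Properties as All
open import Data.List.Relation.Unary.Any using (here; there; satisfied)
open import Data.List.Relation.Unary.Any.Properties using (any⁺; any⁻)
open import Data.Nat using (ℕ; zero; suc; _+_; _*_; _^_; _≤_; _<_; _%_; _/_; _≡ᵇ_; z≤n; s≤s)
open import Data.Nat.DivMod
  using (m≡m%n+[m/n]*n; m%n<n; m*n/n≡m; +-distrib-/-∣ʳ; [m+kn]%n≡m%n; m<n*o⇒m/o<n)
open import Data.Nat.Divisibility using (n∣m*n)
open import Data.Nat.Properties
  using (≤-reflexive; m≤n⇒m≤1+n; +-monoˡ-<; *-monoˡ-≤; *-comm; module ≤-Reasoning)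
open import Data.Product using (Σ; ∃; _×_; _,_; proj₁; proj₂; uncurry)
open import Data.Sum using (inj₁; inj₂; [_,_]′)
open import Data.Vec using (Vec; []; _∷_; _∷ʳ_; lookup; replicate; init; last; initLast)
open import Data.Vec.Properties using (init-∷ʳ; last-∷ʳ; ++-injective; lookup-splitAt; lookup-replicate)
open import Function using (_∘_; id)
open import Function.Bundles using (Equivalence)
open import Relation.Nullary using (contradiction)
open import Relation.Nullary.Decidable using (⌊_⌋; toWitness; fromWitness)
open import Relation.Binary.PropositionalEquality
  using (_≡_; refl; sym; trans; cong; cong₂; subst; module ≡-Reasoning)

open Equivalence using (to; from)

≡true-ext : {a b : Bool} → (a ≡ true → b ≡ true) → (b ≡ true → a ≡ true) → a ≡ b
≡true-ext {false} {false} _ _ = refl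
≡true-ext {false} {true}  _ b⇒a = b⇒a refl
≡true-ext {true}  {false} a⇒b _ = sym (a⇒b refl)
≡true-ext {true}  {true}  _ _ = refl

any-true⁻ : {A : Set} (p : A → Bool) (xs : List A) → any p xs ≡ true → ∃ λ x → p x ≡ true
any-true⁻ p xs h = let x , px = satisfied (any⁻ p xs (from T-≡ h)) in x , to T-≡ px

any-true⁺ : {A : Set} (p : A → Bool) {xs : List A} {x : A} → x ∈ xs → p x ≡ true → any p xs ≡ true
any-true⁺ p x∈xs px = to T-≡ (any⁺ p (lose x∈xs (from T-≡ px)))

module _ {Γ : Set} where

  ⊆ˢ-refl : {X : Sub Γ} → X ⊆ˢ X
  ⊆ˢ-refl _ h = h

  ⊆ˢ-trans : {X Y Z : Sub Γ} → X ⊆ˢ Y → Y ⊆ˢ Z → X ⊆ˢ Z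
  ⊆ˢ-trans X⊆Y Y⊆Z x = Y⊆Z x ∘ X⊆Y x

  ⊆ˢ-antisym : {X Y : Sub Γ} → X ⊆ˢ Y → Y ⊆ˢ X → X ≈ˢ Y
  ⊆ˢ-antisym X⊆Y Y⊆X x = ≡true-ext (X⊆Y x) (Y⊆X x)

  ≈ˢ⇒⊆ˢ : {X Y : Sub Γ} → X ≈ˢ Y → X ⊆ˢ Y
  ≈ˢ⇒⊆ˢ X≈Y x h = trans (sym (X≈Y x)) h

  ≈ˢ-sym : {X Y : Sub Γ} → X ≈ˢ Y → Y ≈ˢ X
  ≈ˢ-sym X≈Y x = sym (X≈Y x)

  ∪ˢ-lub : {X Y Z : Sub Γ} → X ⊆ˢ Z → Y ⊆ˢ Z → (X ∪ˢ Y) ⊆ˢ Z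
  ∪ˢ-lub {X} X⊆Z Y⊆Z x h with X x in Xx
  ... | true  = X⊆Z x Xx
  ... | false = Y⊆Z x h

  ∪ˢ-⊆ʳ : {X Y : Sub Γ} → Y ⊆ˢ (X ∪ˢ Y)
  ∪ˢ-⊆ʳ {X} x h = trans (cong (X x ∨_) h) (∨-zeroʳ (X x))

  ∩ˢ-⊆ˡ : {X Y : Sub Γ} → (X ∩ˢ Y) ⊆ˢ X
  ∩ˢ-⊆ˡ {X} {Y} x = ∧-conicalˡ (X x) (Y x)

  ∩ˢ-⊆ʳ : {X Y : Sub Γ} → (X ∩ˢ Y) ⊆ˢ Y
  ∩ˢ-⊆ʳ {X} {Y} x = ∧-conicalʳ (X x) (Y x)

  ∩ˢ-mono : {X X′ Y Y′ : Sub Γ} → X ⊆ˢ X′ → Y ⊆ˢ Y′ → (X ∩ˢ Y) ⊆ˢ (X′ ∩ˢ Y′)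
  ∩ˢ-mono {X} {X′} {Y} {Y′} X⊆X′ Y⊆Y′ x h =
    cong₂ _∧_ (X⊆X′ x (∩ˢ-⊆ˡ {X} {Y} x h)) (Y⊆Y′ x (∩ˢ-⊆ʳ {X} {Y} x h))

-- Generating sequences

module _ {Γ : Set} {𝓑 : List (Sub Γ)} where

  GenSeq-∩≤length : {As : List (Sub Γ)} {k : ℕ} → GenSeq 𝓑 As k → k ≤ length As
  GenSeq-∩≤length []            = z≤n
  GenSeq-∩≤length (∪stp gs _ _) = m≤n⇒m≤1+n (GenSeq-∩≤length gs)
  GenSeq-∩≤length (∩stp gs _ _) = s≤s (GenSeq-∩≤length gs)

  Generates-∩≤length : {A : Sub Γ} {t k : ℕ} → Generates 𝓑 A t k → k ≤ t
  Generates-∩≤length (_ , _ , gs , refl , _) = GenSeq-∩≤length gs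

module _ {Γ : Set} (𝓑 : List (Sub Γ)) where

  Available : List (Sub Γ) → Sub Γ → Set
  Available As X = Σ (Sub Γ) λ B → B ∈ 𝓑 ++ˡ As × B ≈ˢ X

  Available-mono : {As As′ : List (Sub Γ)} {X : Sub Γ} → As ⊆ As′ → Available As X → Available As′ X
  Available-mono As⊆As′ (B , B∈ , B≈X) = B , ++⁺ʳ 𝓑 As⊆As′ B∈ , B≈X

  Available-resp : {As : List (Sub Γ)} {X Y : Sub Γ} → X ≈ˢ Y → Available As X → Available As Y
  Available-resp X≈Y (B , B∈ , B≈X) = B , B∈ , λ x → trans (B≈X x) (X≈Y x)

  record ∪-Extension (As : List (Sub Γ)) (k : ℕ) (X : Sub Γ) : Set where
    field
      {extended} : List (Sub Γ)
      sequence   : GenSeq 𝓑 extended k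
      extends    : As ⊆ extended
      available  : Available extended X

  open ∪-Extension public

  ∪-Extension-resp : {As : List (Sub Γ)} {k : ℕ} {X Y : Sub Γ} →
    X ≈ˢ Y → ∪-Extension As k X → ∪-Extension As k Y
  ∪-Extension-resp X≈Y ext = record
    { sequence = sequence ext ; extends = extends ext ; available = Available-resp X≈Y (available ext) }

  data UnionOf : Sub Γ → Set where
    [_] : {B : Sub Γ} → B ∈ 𝓑 → UnionOf B
    _∷_ : {B X : Sub Γ} → B ∈ 𝓑 → UnionOf X → UnionOf (B ∪ˢ X)

  UnionOf-∪-extension : {As : List (Sub Γ)} {k : ℕ} {X : Sub Γ} →
    UnionOf X → GenSeq 𝓑 As k → ∪-Extension As k X
  UnionOf-∪-extension [ B∈ ] gs = record
    { sequence = gs ; extends = ⊆-refl ; available = _ , ∈-++⁺ˡ B∈ , λ _ → refl }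
  UnionOf-∪-extension (_∷_ {B} B∈ U) gs with UnionOf-∪-extension U gs
  ... | ext@record { available = C , C∈ , C≈X } = record
    { sequence  = ∪stp (sequence ext) (∈-++⁺ˡ B∈) C∈
    ; extends   = ⊆-trans (extends ext) (xs⊆x∷xs _ _)
    ; available = B ∪ˢ C , ∈-++⁺ʳ 𝓑 (here refl) , λ x → cong (B x ∨_) (C≈X x)
    }

PullsBackToUnions : {Γ Δ : Set} → List (Sub Δ) → List (Sub Γ) → (Δ → Γ) → Set
PullsBackToUnions 𝓑′ 𝓑 g = ∀ {X} → X ∈ 𝓑 → Σ _ λ Y → UnionOf 𝓑′ Y × Y ≈ˢ (X ∘ g)

module _ {Γ Δ : Set} {𝓑 : List (Sub Γ)} {𝓑′ : List (Sub Δ)} (g : Δ → Γ)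
         (pullbacks-are-unions : PullsBackToUnions 𝓑′ 𝓑 g) where

  Simulates : List (Sub Γ) → List (Sub Δ) → Set
  Simulates As Bs = ∀ {A} → A ∈ As → Available 𝓑′ Bs (A ∘ g)

  Simulates-mono : {As : List (Sub Γ)} {Bs Bs′ : List (Sub Δ)} →
    Bs ⊆ Bs′ → Simulates As Bs → Simulates As Bs′
  Simulates-mono Bs⊆Bs′ sim A∈ = Available-mono 𝓑′ Bs⊆Bs′ (sim A∈)

  Simulates-∷ : {As : List (Sub Γ)} {Bs : List (Sub Δ)} {A : Sub Γ} {B : Sub Δ} →
    B ≈ˢ (A ∘ g) → Simulates As Bs → Simulates (A ∷ As) (B ∷ Bs)
  Simulates-∷ B≈ _   (here refl) = _ , ∈-++⁺ʳ 𝓑′ (here refl) , B≈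
  Simulates-∷ _  sim (there A∈)  = Simulates-mono (xs⊆x∷xs _ _) sim A∈

  fetch : {As : List (Sub Γ)} {Bs : List (Sub Δ)} {k : ℕ} {X : Sub Γ} →
    GenSeq 𝓑′ Bs k → Simulates As Bs → X ∈ 𝓑 ++ˡ As → ∪-Extension 𝓑′ Bs k (X ∘ g)
  fetch gs sim X∈ with ∈-++⁻ 𝓑 X∈
  ... | inj₂ X∈As = record { sequence = gs ; extends = ⊆-refl ; available = sim X∈As }
  ... | inj₁ X∈𝓑 with pullbacks-are-unions X∈𝓑
  ...   | Y , U , Y≈ = ∪-Extension-resp 𝓑′ Y≈ (UnionOf-∪-extension 𝓑′ U gs)

  fetch₂ : {As : List (Sub Γ)} {Bs : List (Sub Δ)} {k : ℕ} {X Y : Sub Γ} →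
    GenSeq 𝓑′ Bs k → Simulates As Bs → X ∈ 𝓑 ++ˡ As → Y ∈ 𝓑 ++ˡ As →
    Σ (List (Sub Δ)) λ Bs′ → GenSeq 𝓑′ Bs′ k × Simulates As Bs′ ×
      Available 𝓑′ Bs′ (X ∘ g) × Available 𝓑′ Bs′ (Y ∘ g)
  fetch₂ gs sim X∈ Y∈ with fetch gs sim X∈
  ... | eX with fetch (sequence eX) (Simulates-mono (extends eX) sim) Y∈
  ...   | eY = _ , sequence eY , Simulates-mono (⊆-trans (extends eX) (extends eY)) sim ,
               Available-mono 𝓑′ (extends eY) (available eX) , available eY

  simulate : {As : List (Sub Γ)} {k : ℕ} → GenSeq 𝓑 As k →
    Σ (List (Sub Δ)) λ Bs → GenSeq 𝓑′ Bs k × Simulates As Bs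
  simulate [] = [] , [] , λ ()
  simulate (∪stp gs X∈ Y∈) with simulate gs
  ... | _ , gs′ , sim with fetch₂ gs′ sim X∈ Y∈
  ...   | _ , gs″ , sim′ , (BX , BX∈ , BX≈) , (BY , BY∈ , BY≈) =
    _ , ∪stp gs″ BX∈ BY∈ , Simulates-∷ (λ d → cong₂ _∨_ (BX≈ d) (BY≈ d)) sim′
  simulate (∩stp gs X∈ Y∈) with simulate gs
  ... | _ , gs′ , sim with fetch₂ gs′ sim X∈ Y∈
  ...   | _ , gs″ , sim′ , (BX , BX∈ , BX≈) , (BY , BY∈ , BY≈) =
    _ , ∩stp gs″ BX∈ BY∈ , Simulates-∷ (λ d → cong₂ _∧_ (BX≈ d) (BY≈ d)) sim′

  -- Aₜ ∘ g is only available somewhere in the simulating sequence; the idle step B ∪ B puts it last.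
  Generates-pullback : {A : Sub Γ} {A′ : Sub Δ} {t k : ℕ} →
    (A ∘ g) ≈ˢ A′ → Generates 𝓑 A t k → Σ ℕ λ t′ → Generates 𝓑′ A′ t′ k
  Generates-pullback {A} {A′} A∘g≈A′ (Aₜ , _ , gs , _ , Aₜ≈A) with simulate gs
  ... | Bs , gs′ , sim with sim (here refl)
  ...   | B , B∈ , B≈ = suc (length Bs) , B ∪ˢ B , Bs , ∪stp gs′ B∈ B∈ , refl , B∪B≈A′
    where
      open ≡-Reasoning
      B∪B≈A′ : (B ∪ˢ B) ≈ˢ A′
      B∪B≈A′ d = begin
        B d ∨ B d  ≡⟨ ∨-idem (B d) ⟩
        B d        ≡⟨ B≈ d ⟩
        Aₜ (g d)   ≡⟨ Aₜ≈A (g d) ⟩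
        A (g d)    ≡⟨ A∘g≈A′ d ⟩
        A′ d       ∎

-- Semi-filters

pullbackPair : {Γ Δ : Set} → (Δ → Γ) → Sub Γ × Sub Γ → Sub Δ × Sub Δ
pullbackPair g (E , H) = E ∘ g , H ∘ g

Refines : {Γ Δ : Set} → List (Sub Δ) → List (Sub Γ) → (Δ → Γ) → Set
Refines 𝓑′ 𝓑 g = ∀ a {B} → B ∈ 𝓑 → B (g a) ≡ true →
  Σ _ λ R → R ∈ 𝓑′ × R a ≡ true × R ⊆ˢ (B ∘ g)

module _ {Γ Δ : Set} (g : Δ → Γ) {U : Sub Γ} {U′ : Sub Δ} (U∘g≈U′ : (U ∘ g) ≈ˢ U′) where

  private
    U∘g⊆U′ : (U ∘ g) ⊆ˢ U′
    U∘g⊆U′ = ≈ˢ⇒⊆ˢ U∘g≈U′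

    U′⊆U∘g : U′ ⊆ˢ (U ∘ g)
    U′⊆U∘g = ≈ˢ⇒⊆ˢ (≈ˢ-sym U∘g≈U′)

  pushforward : SemiFilter U′ → SemiFilter U
  pushforward F′ = record
    { 𝓕        = λ X → X ⊆ˢ U × 𝓕 F′ (X ∘ g)
    ; inP      = λ _ → proj₁
    ; nonempty = let X′ , X′∈ = nonempty F′ in U , ⊆ˢ-refl ,
                 upward F′ X′ (U ∘ g) X′∈ (⊆ˢ-trans (inP F′ X′ X′∈) U′⊆U∘g) U∘g⊆U′
    ; no∅      = no∅ F′ ∘ proj₂
    ; upward   = λ X Y X∈ X⊆Y Y⊆U →
                 Y⊆U , upward F′ (X ∘ g) (Y ∘ g) (proj₂ X∈) (X⊆Y ∘ g) (⊆ˢ-trans (Y⊆U ∘ g) U∘g⊆U′)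
    }

  pushforward-above : {𝓑 : List (Sub Γ)} {𝓑′ : List (Sub Δ)} {F′ : SemiFilter U′} {a : Δ} →
    Refines 𝓑′ 𝓑 g → Above 𝓑′ U′ F′ a → Above 𝓑 U (pushforward F′) (g a)
  pushforward-above {F′ = F′} {a} refines above B B∈ Bga with refines a B∈ Bga
  ... | R , R∈ , Ra , R⊆B∘g =
    ∩ˢ-⊆ʳ {X = B} ,
    upward F′ (R ∩ˢ U′) ((B ∩ˢ U) ∘ g) (above R R∈ Ra)
      (∩ˢ-mono {X = R} R⊆B∘g U′⊆U∘g) (⊆ˢ-trans (∩ˢ-⊆ʳ {X = B ∘ g}) U∘g⊆U′)

  pushforward-preserves : {F′ : SemiFilter U′} {Λ : List (Sub Γ × Sub Γ)} →
    Preserves F′ (map (pullbackPair g) Λ) → Preserves (pushforward F′) Λ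
  pushforward-preserves preserves =
    All.map (λ { {E , H} preserves-EH (E⊆U , E∈) (_ , H∈) →
                   ⊆ˢ-trans (∩ˢ-⊆ˡ {X = E}) E⊆U , preserves-EH E∈ H∈ })
            (All.map⁻ preserves)

RhoWitness-pullback : {Γ Δ : Set} {𝓑 : List (Sub Γ)} {𝓑′ : List (Sub Δ)} (g : Δ → Γ)
  {A : Sub Γ} {A′ : Sub Δ} {Λ : List (Sub Γ × Sub Γ)} →
  (A ∘ g) ≈ˢ A′ → Refines 𝓑′ 𝓑 g →
  RhoWitness A 𝓑 Λ → RhoWitness A′ 𝓑′ (map (pullbackPair g) Λ)
RhoWitness-pullback {Γ} g {A} {A′} A∘g≈A′ refines (Λ⊆∁A , no-filter) =
  All.map⁺ (All.map (λ (E⊆ , H⊆) → pull E⊆ , pull H⊆) Λ⊆∁A) ,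
  λ (F′ , a , A′a , above , preserves) → no-filter
    ( pushforward g ∁A∘g≈∁A′ F′ , g a , trans (A∘g≈A′ a) A′a
    , pushforward-above g ∁A∘g≈∁A′ {F′ = F′} refines above
    , pushforward-preserves g ∁A∘g≈∁A′ {F′ = F′} preserves )
  where
    ∁A∘g≈∁A′ : (∁ A ∘ g) ≈ˢ ∁ A′
    ∁A∘g≈∁A′ d = cong not (A∘g≈A′ d)

    pull : {X : Sub Γ} → X ⊆ˢ ∁ A → (X ∘ g) ⊆ˢ ∁ A′
    pull X⊆∁A = ⊆ˢ-trans (X⊆∁A ∘ g) (≈ˢ⇒⊆ˢ ∁A∘g≈∁A′)

module _ {Δ : Set} {N : ℕ} (key : Δ → Fin N) where

  Fibre : Fin N → Sub Δ
  Fibre k d = ⌊ key d ≟ k ⌋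

  Fibre-self : ∀ d → Fibre (key d) d ≡ true
  Fibre-self d = to T-≡ (fromWitness refl)

  Fibre-⊆ : {s : Fin N → Bool} {k : Fin N} → s k ≡ true → Fibre k ⊆ˢ (s ∘ key)
  Fibre-⊆ {s} sk d h = subst (λ k → s k ≡ true) (sym (toWitness (from T-≡ h))) sk

  module _ {𝓑 : List (Sub Δ)} (fibres∈𝓑 : ∀ k → Fibre k ∈ 𝓑)
           {s : Fin N → Bool} {u : Fin N} (su : s u ≡ true) where

    -- Fibre u seeds the union, since UnionOf has no empty union.
    ⋃-fibres-over : (ks : List (Fin N)) → Σ (Sub Δ) λ X → UnionOf 𝓑 X × X ⊆ˢ (s ∘ key) ×
      (∀ {k} → k ∈ ks → s k ≡ true → Fibre k ⊆ˢ X)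
    ⋃-fibres-over [] = Fibre u , [ fibres∈𝓑 u ] , Fibre-⊆ su , λ ()
    ⋃-fibres-over (k ∷ ks) with s k in sk | ⋃-fibres-over ks
    ... | false | X , U , X⊆s∘key , fibres⊆X = X , U , X⊆s∘key , λ
      { (here refl) sk′ → contradiction (trans (sym sk) sk′) λ ()
      ; (there k∈)       → fibres⊆X k∈ }
    ... | true  | X , U , X⊆s∘key , fibres⊆X =
      Fibre k ∪ˢ X , fibres∈𝓑 k ∷ U , ∪ˢ-lub (Fibre-⊆ sk) X⊆s∘key , λ
      { (here refl) _ d h   → cong (_∨ X d) h
      ; (there k∈)  sk′ d h → ∪ˢ-⊆ʳ {X = Fibre k} {X} d (fibres⊆X k∈ sk′ d h) }

    ⋃-fibres : Σ (Sub Δ) λ X → UnionOf 𝓑 X × X ≈ˢ (s ∘ key)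
    ⋃-fibres with ⋃-fibres-over (allFin N)
    ... | X , U , X⊆s∘key , fibres⊆X =
      X , U , ⊆ˢ-antisym X⊆s∘key (λ d skd → fibres⊆X (∈-allFin (key d)) skd d (Fibre-self d))

-- Binary representation

bitValue : Bool → ℕ
bitValue false = 0
bitValue true  = 1

fromBits : {n : ℕ} → Vec Bool n → ℕ
fromBits {zero}  []  = 0
fromBits {suc n} bs = bitValue (last bs) + fromBits (init bs) * 2

fromBits<2^n : (n : ℕ) (bs : Vec Bool n) → fromBits bs < 2 ^ n
fromBits<2^n zero    []  = s≤s z≤n
fromBits<2^n (suc n) bs = begin-strict
  bitValue (last bs) + fromBits (init bs) * 2  <⟨ +-monoˡ-< (fromBits (init bs) * 2) (bitValue<2 (last bs)) ⟩
  suc (fromBits (init bs)) * 2                 ≤⟨ *-monoˡ-≤ 2 (fromBits<2^n n (init bs)) ⟩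
  2 ^ n * 2                                    ≡⟨ *-comm (2 ^ n) 2 ⟩
  2 ^ suc n                                    ∎
  where
    open ≤-Reasoning
    bitValue<2 : ∀ b → bitValue b < 2
    bitValue<2 false = s≤s z≤n
    bitValue<2 true  = s≤s (s≤s z≤n)

binℕ-fromBits : (n : ℕ) (bs : Vec Bool n) → binℕ n (fromBits bs) ≡ bs
binℕ-fromBits zero    []  = refl
binℕ-fromBits (suc n) bs = begin
  binℕ n (m / 2) ∷ʳ (m % 2 ≡ᵇ 1)  ≡⟨ cong₂ _∷ʳ_ (cong (binℕ n) (halve (last bs) q)) (parity (last bs) q) ⟩
  binℕ n q ∷ʳ last bs             ≡⟨ cong (_∷ʳ last bs) (binℕ-fromBits n (init bs)) ⟩
  init bs ∷ʳ last bs              ≡⟨ sym (proj₂ (proj₂ (initLast bs))) ⟩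
  bs                              ∎
  where
    open ≡-Reasoning
    q m : ℕ
    q = fromBits (init bs)
    m = bitValue (last bs) + q * 2

    halve : ∀ b r → (bitValue b + r * 2) / 2 ≡ r
    halve false r = m*n/n≡m r 2
    halve true  r = trans (+-distrib-/-∣ʳ 1 {d = 2} (n∣m*n r)) (m*n/n≡m r 2)

    parity : ∀ b r → ((bitValue b + r * 2) % 2 ≡ᵇ 1) ≡ b
    parity false r = cong (_≡ᵇ 1) ([m+kn]%n≡m%n 0 r 2)
    parity true  r = cong (_≡ᵇ 1) ([m+kn]%n≡m%n 1 r 2)

fromBits-binℕ : (n m : ℕ) → m < 2 ^ n → fromBits (binℕ n m) ≡ m
fromBits-binℕ zero    zero    _ = refl
fromBits-binℕ zero    (suc m) (s≤s ())
fromBits-binℕ (suc n) m       m<2^[1+n] = begin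
  bitValue (last (bs ∷ʳ b)) + fromBits (init (bs ∷ʳ b)) * 2
    ≡⟨ cong₂ (λ b′ bs′ → bitValue b′ + fromBits bs′ * 2) (last-∷ʳ b bs) (init-∷ʳ b bs) ⟩
  bitValue b + fromBits bs * 2
    ≡⟨ cong₂ _+_ (bitValue-parity m) (cong (_* 2) (fromBits-binℕ n (m / 2) m/2<2^n)) ⟩
  m % 2 + m / 2 * 2
    ≡⟨ sym (m≡m%n+[m/n]*n m 2) ⟩
  m ∎
  where
    open ≡-Reasoning
    bs : Vec Bool n
    bs = binℕ n (m / 2)
    b : Bool
    b = m % 2 ≡ᵇ 1

    m/2<2^n : m / 2 < 2 ^ n
    m/2<2^n = m<n*o⇒m/o<n (subst (m <_) (*-comm 2 (2 ^ n)) m<2^[1+n])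

    bitValue-parity : ∀ k → bitValue (k % 2 ≡ᵇ 1) ≡ k % 2
    bitValue-parity k with k % 2 | m%n<n k 2
    ... | 0 | _ = refl
    ... | 1 | _ = refl
    ... | suc (suc _) | s≤s (s≤s ())

module _ (n : ℕ) where

  bin-injective : {u v : Fin (2 ^ n)} → bin n u ≡ bin n v → u ≡ v
  bin-injective {u} {v} bin-u≡bin-v = toℕ-injective (begin
    toℕ u                    ≡⟨ sym (fromBits-binℕ n (toℕ u) (toℕ<n u)) ⟩
    fromBits (bin n u)       ≡⟨ cong fromBits bin-u≡bin-v ⟩
    fromBits (bin n v)       ≡⟨ fromBits-binℕ n (toℕ v) (toℕ<n v) ⟩
    toℕ v                    ∎)
    where open ≡-Reasoning

  bin-surjective : (bs : Vec Bool n) → ∃ λ u → bin n u ≡ bs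
  bin-surjective bs = fromℕ< (fromBits<2^n n bs) ,
    trans (cong (binℕ n) (toℕ-fromℕ< (fromBits<2^n n bs))) (binℕ-fromBits n bs)

eqBits-refl : {m : ℕ} (bs : Vec Bool m) → eqBits bs bs ≡ true
eqBits-refl []           = refl
eqBits-refl (true ∷ bs)  = eqBits-refl bs
eqBits-refl (false ∷ bs) = eqBits-refl bs

eqBits-sound : {m : ℕ} (bs cs : Vec Bool m) → eqBits bs cs ≡ true → bs ≡ cs
eqBits-sound []           []           _ = refl
eqBits-sound (true ∷ bs)  (true ∷ cs)  h = cong (true ∷_) (eqBits-sound bs cs h)
eqBits-sound (false ∷ bs) (false ∷ cs) h = cong (false ∷_) (eqBits-sound bs cs h)

-- The encoding φ

module _ (n : ℕ) where

  φ₂ : Fin (2 ^ n) × Fin (2 ^ n) → Vec Bool (n + n)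
  φ₂ = uncurry (φ n)

  φ₂-injective : {p q : Fin (2 ^ n) × Fin (2 ^ n)} → φ₂ p ≡ φ₂ q → p ≡ q
  φ₂-injective {u , v} {u′ , v′} φuv≡φu′v′ =
    let bin-u≡ , bin-v≡ = ++-injective (bin n u) (bin n u′) φuv≡φu′v′
    in cong₂ _,_ (bin-injective n bin-u≡) (bin-injective n bin-v≡)

  lookup-φ₂ : (i : Fin (n + n)) (p : Fin (2 ^ n) × Fin (2 ^ n)) →
    lookup (φ₂ p) i ≡ [ lookup (bin n (proj₁ p)) , lookup (bin n (proj₂ p)) ]′ (splitAt n i)
  lookup-φ₂ i (u , v) = lookup-splitAt n (bin n u) (bin n v) i

  fG⁻¹1∘φ₂≈G : (G : Sub (Fin (2 ^ n) × Fin (2 ^ n))) → (fG⁻¹1 n G ∘ φ₂) ≈ˢ G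
  fG⁻¹1∘φ₂≈G G = ⊆ˢ-antisym sound complete
    where
      sound : (fG⁻¹1 n G ∘ φ₂) ⊆ˢ G
      sound (u , v) h with any-true⁻ _ (allFin (2 ^ n)) h
      ... | u′ , h′ with any-true⁻ _ (allFin (2 ^ n)) h′
      ...   | v′ , h″ =
        subst (λ p → G p ≡ true)
              (φ₂-injective (eqBits-sound _ _ (∧-conicalʳ (G (u′ , v′)) _ h″)))
              (∧-conicalˡ _ _ h″)

      complete : G ⊆ˢ (fG⁻¹1 n G ∘ φ₂)
      complete (u , v) h =
        any-true⁺ _ (∈-allFin u) (any-true⁺ _ (∈-allFin v) (cong₂ _∧_ h (eqBits-refl (φ n u v))))

  row∈𝓖 : (k : Fin (2 ^ n)) → Fibre proj₁ k ∈ 𝓖 (2 ^ n)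
  row∈𝓖 k = ∈-++⁺ˡ (∈-map⁺ (Row (2 ^ n)) (∈-allFin k))

  col∈𝓖 : (k : Fin (2 ^ n)) → Fibre proj₂ k ∈ 𝓖 (2 ^ n)
  col∈𝓖 k = ∈-++⁺ʳ (map (Row (2 ^ n)) (allFin (2 ^ n))) (∈-map⁺ (Col (2 ^ n)) (∈-allFin k))

  record Cylinder (X : Sub (Fin (2 ^ n) × Fin (2 ^ n))) : Set where
    field
      key       : Fin (2 ^ n) × Fin (2 ^ n) → Fin (2 ^ n)
      fibres∈𝓖  : ∀ k → Fibre key k ∈ 𝓖 (2 ^ n)
      base      : Fin (2 ^ n) → Bool
      inhabited : ∃ λ u → base u ≡ true
      X≈base∘key : X ≈ˢ (base ∘ key)

  bitCylinder : {X : Sub (Fin (2 ^ n) × Fin (2 ^ n))} (h : Bool → Bool) {b : Bool} → h b ≡ true →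
    (key : Fin (2 ^ n) × Fin (2 ^ n) → Fin (2 ^ n)) → (∀ k → Fibre key k ∈ 𝓖 (2 ^ n)) →
    (j : Fin n) → X ≈ˢ (λ p → h (lookup (bin n (key p)) j)) → Cylinder X
  bitCylinder h {b} hb key fibres∈𝓖 j X≈ with bin-surjective n (replicate n b)
  ... | u , bin-u≡bs = record
    { key = key ; fibres∈𝓖 = fibres∈𝓖 ; base = base ; inhabited = u , base-u ; X≈base∘key = X≈ }
    where
      base : Fin (2 ^ n) → Bool
      base u = h (lookup (bin n u) j)

      base-u : base u ≡ true
      base-u = begin
        h (lookup (bin n u) j)        ≡⟨ cong (λ bs → h (lookup bs j)) bin-u≡bs ⟩
        h (lookup (replicate n b) j)  ≡⟨ cong h (lookup-replicate j b) ⟩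
        h b                           ≡⟨ hb ⟩
        true                          ∎
        where open ≡-Reasoning

  coordinateCylinder : (h : Bool → Bool) {b : Bool} → h b ≡ true → (i : Fin (n + n)) →
    Cylinder (λ p → h (lookup (φ₂ p) i))
  coordinateCylinder h hb i with splitAt n i | lookup-φ₂ i
  ... | inj₁ j | lookup-φ₂-i = bitCylinder h hb proj₁ row∈𝓖 j (cong h ∘ lookup-φ₂-i)
  ... | inj₂ j | lookup-φ₂-i = bitCylinder h hb proj₂ col∈𝓖 j (cong h ∘ lookup-φ₂-i)

  generator-cylinder : {X : Sub (Vec Bool (n + n))} → X ∈ 𝓑 (n + n) → Cylinder (X ∘ φ₂)
  generator-cylinder X∈ with ∈-++⁻ (map (Bit (n + n)) (allFin (n + n))) X∈
  ... | inj₁ X∈bits with ∈-map⁻ (Bit (n + n)) X∈bits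
  ...   | i , _ , refl = coordinateCylinder id {true} refl i
  generator-cylinder X∈ | inj₂ X∈cobits with ∈-map⁻ (λ i → ∁ (Bit (n + n) i)) X∈cobits
  ...   | i , _ , refl = coordinateCylinder not {false} refl i

  generators-pull-back-to-unions : PullsBackToUnions (𝓖 (2 ^ n)) (𝓑 (n + n)) φ₂
  generators-pull-back-to-unions X∈ =
    let open Cylinder (generator-cylinder X∈)
        Y , U , Y≈ = ⋃-fibres key fibres∈𝓖 {s = base} (proj₂ inhabited)
    in Y , U , λ p → trans (Y≈ p) (sym (X≈base∘key p))

  generators-refine : Refines (𝓖 (2 ^ n)) (𝓑 (n + n)) φ₂
  generators-refine a B∈ Bφa =
    let open Cylinder (generator-cylinder B∈)
    in Fibre key (key a) , fibres∈𝓖 (key a) , Fibre-self key a ,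
       ⊆ˢ-trans (Fibre-⊆ key {s = base} (trans (sym (X≈base∘key a)) Bφa))
                (≈ˢ⇒⊆ˢ (≈ˢ-sym X≈base∘key))

lemma1p1 : (n : ℕ) → 1 ≤ n →
    (G : Sub (Fin (2 ^ n) × Fin (2 ^ n))) → NonTrivial G →
    ((Λ : List (Sub (Vec Bool (n + n)) × Sub (Vec Bool (n + n)))) →
        RhoWitness (fG⁻¹1 n G) (𝓑 (n + n)) Λ →
        Σ (List (Sub (Fin (2 ^ n) × Fin (2 ^ n)) × Sub (Fin (2 ^ n) × Fin (2 ^ n)))) λ Λ′ →
          RhoWitness G (𝓖 (2 ^ n)) Λ′ × length Λ′ ≤ length Λ)
    × ((t k : ℕ) → Generates (𝓑 (n + n)) (fG⁻¹1 n G) t k →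
        Σ ℕ λ t′ → Σ ℕ λ k′ → Generates (𝓖 (2 ^ n)) G t′ k′ × k′ ≤ t)
lemma1p1 n _ G _ =
  (λ Λ witness →
    map (pullbackPair (φ₂ n)) Λ ,
    RhoWitness-pullback (φ₂ n) (fG⁻¹1∘φ₂≈G n G) (generators-refine n) witness ,
    ≤-reflexive (length-map (pullbackPair (φ₂ n)) Λ)) ,
  (λ t k generates →
    let t′ , generates′ = Generates-pullback (φ₂ n) (generators-pull-back-to-unions n)
                            (fG⁻¹1∘φ₂≈G n G) generates
    in t′ , k , generates′ , Generates-∩≤length generates)
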